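{- Let $k\ge5$ and $n\le k+2$. Then there is no antipodal $k$-splitting of $Q_2^n$.
   Context: $Q_2^n=\{0,1\}^n$. An $m$-face of $Q_2^n$ is a tuple $a\in\{0,1,*\}^n$ with exactly $m$ entries $*$, identified with $\{x\in Q_2^n: x_i=a_i$ whenever $a_i\in\{0,1\}\}$. Faces are parallel if their sets of $*$-positions coincide; parallel faces $a,b$ are antipodal if $b_i=1-a_i$ whenever $a_i\ne*$. An antipodal $k$-splitting of $Q_2^n$ is a collection of exactly $2^k$ $(n-k)$-faces whose union is $Q_2^n$ and which contains no two distinct parallel non-antipodal faces. -}

module Defs where

open import Data.Nat using (ℕ; _+_; _^_)
open import Data.Bool using (Bool; true; false)
open import Data.Fin using (Fin)
open import Data.Vec using (Vec; lookup)
open import Data.Product using (Σ; ∃; _×_)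
open import Function.Definitions using (Injective)
open import Relation.Binary.PropositionalEquality using (_≡_; _≢_)

data Sym : Set where
  c0 c1 star : Sym

Point : ℕ → Set
Point n = Vec Bool n

Tuple : ℕ → Set
Tuple n = Vec Sym n

stars : ∀ {n} → Tuple n → ℕ
stars Data.Vec.[] = 0
stars (star Data.Vec.∷ a) = Data.Nat.suc (stars a)
stars (c0 Data.Vec.∷ a) = stars a
stars (c1 Data.Vec.∷ a) = stars a

IsFace : ∀ {n} → ℕ → Tuple n → Set
IsFace m a = stars a ≡ m

MatchSym : Sym → Bool → Set
MatchSym c0 b = b ≡ false
MatchSym c1 b = b ≡ true
MatchSym star b = Data.Unit.⊤
  where import Data.Unit

_∈F_ : ∀ {n} → Point n → Tuple n → Set
x ∈F a = ∀ i → MatchSym (lookup a i) (lookup x i)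

Parallel : ∀ {n} → Tuple n → Tuple n → Set
Parallel a b = ∀ i → (lookup a i ≡ star → lookup b i ≡ star) × (lookup b i ≡ star → lookup a i ≡ star)

flipS : Sym → Sym
flipS c0 = c1
flipS c1 = c0
flipS star = star

Antipodal : ∀ {n} → Tuple n → Tuple n → Set
Antipodal a b = Parallel a b × (∀ i → lookup a i ≢ star → lookup b i ≡ flipS (lookup a i))

record AntipodalSplitting (n k : ℕ) : Set where
  field
    m        : ℕ
    dim      : k + m ≡ n
    face     : Fin (2 ^ k) → Tuple n
    injective : Injective _≡_ _≡_ face
    isFace   : ∀ i → IsFace m (face i)
    covers   : ∀ (x : Point n) → ∃ λ i → x ∈F face i
    antipodal : ∀ i j → face i ≢ face j → Parallel (face i) (face j) → Antipodal (face i) (face j)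

-- Two faces with the same star set are equal or antipodal, so each star set carries at most two
-- of the 2^k faces of dimension m = n - k, whence 2^k ≤ 2·C(n,m).  For k ≥ 5 and m ≤ 2 this
-- fails except when (k, m) = (5, 2), i.e. for 32 two-dimensional faces covering Q_2^7.  There a
-- character argument applies: for U ≠ ∅ the faces with no star position in U are balanced
-- between the two U-parities.  With U = ∁ Q it shows that every star set Q carries 0 or 2 faces;
-- with U = ∁ T for |T| = 3 (so |U| is even and antipodal faces have the same U-parity) it shows
-- that T contains the star sets of 0 or 4 faces.  Counting the pairs (face, T) with the star set
-- of the face inside T then gives 5 · 32 ≤ 4 · 35.
module Submission where

open import Defs
open import Data.Bool using (Bool; true; false; not; _∧_; _xor_; if_then_else_)
open import Data.Bool.Properties
  using (_≟_; xor-assoc; xor-comm; xor-identityʳ; ∧-zeroʳ; not-involutive; not-distribʳ-xor)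
open import Data.Fin using (Fin; zero; suc)
open import Data.Fin.Properties using (any?)
import Data.Fin.Properties as Fin
open import Data.Fin.Subset using (Subset; ⊤; ∁; _⊆_; ∣_∣) renaming (⊥ to ∅)
open import Data.Fin.Subset.Properties
  using (_⊆?_; anySubset?; drop-∷-⊆; p⊆q⇒∣p∣≤∣q∣; ⊆⊤; ∣⊤∣≡n; ⊆-reflexive; ∣∁p∣≡n∸∣p∣; ∣⊥∣≡0)
open import Data.Nat using (ℕ; zero; suc; _+_; _*_; _^_; _∸_; _≤_; _<_; z≤n; s≤s)
open import Data.Nat.Combinatorics using (_C_; nC1≡n; nCk+nC[k+1]≡[n+1]C[k+1])
open import Data.Nat.Divisibility using (_∣_; divides; _∣0; ∣m∣n⇒∣m+n; ∣n⇒∣m*n; *-monoʳ-∣)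
open import Data.Nat.Properties hiding (_≟_)
open import Data.Nat.Properties using () renaming (_≟_ to _≟ℕ_)
open import Data.Nat.Tactic.RingSolver using (solve-∀)
open import Data.Product using (∃; _×_; _,_; proj₁; proj₂)
open import Data.Sum using (_⊎_; inj₁; inj₂)
open import Data.Vec using (Vec; []; _∷_; lookup; map; here)
open import Data.Vec.Properties using (≡-dec; ∷-injective; lookup-map; tabulate∘lookup; tabulate-cong)
open import Function using (_∘_; case_of_)
open import Function.Bundles using (mk⇔)
open import Function.Definitions using (Injective)
open import Relation.Binary.Definitions using (DecidableEquality)
open import Relation.Binary.PropositionalEquality
open import Relation.Nullary using (¬_; Dec; yes; no; does; contradiction)
open import Relation.Nullary.Decidable
  using (dec-true; dec-false; does-⇔; from-no; decidable-stable; ¬?; _→-dec_; _×-dec_)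
open import Algebra.Properties.Semiring.Sum +-*-semiring
  using (sum-syntax; sum-cong-≗; ∑-distrib-+; *-distribˡ-sum)
open import Algebra.Properties.CommutativeSemigroup +-commutativeSemigroup
  using () renaming (interchange to +-interchange)

-- Sums over Fin N and over the cube

𝟙 : Bool → ℕ
𝟙 true  = 1
𝟙 false = 0

𝟙-∧ : ∀ a b → 𝟙 (a ∧ b) ≡ 𝟙 a * 𝟙 b
𝟙-∧ true  b = sym (+-identityʳ (𝟙 b))
𝟙-∧ false b = refl

𝟙-split : ∀ a z → 𝟙 (a ∧ does (z ≟ true)) + 𝟙 (a ∧ does (z ≟ false)) ≡ 𝟙 a
𝟙-split false z     = refl
𝟙-split true  true  = refl
𝟙-split true  false = refl

m+m≡m*2 : ∀ m → m + m ≡ m * 2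
m+m≡m*2 m = trans (cong (m +_) (sym (+-identityʳ m))) (*-comm 2 m)

∑-const : ∀ N c → ∑[ i < N ] c ≡ N * c
∑-const zero    c = refl
∑-const (suc N) c = cong (c +_) (∑-const N c)

∑-zero : ∀ {N} {f : Fin N → ℕ} → (∀ i → f i ≡ 0) → ∑[ i < N ] f i ≡ 0
∑-zero {N} f≗0 = trans (sum-cong-≗ f≗0) (trans (∑-const N 0) (*-zeroʳ N))

∑-mono : ∀ {N} {f g : Fin N → ℕ} → (∀ i → f i ≤ g i) → ∑[ i < N ] f i ≤ ∑[ i < N ] g i
∑-mono {zero}  f≤g = z≤n
∑-mono {suc N} f≤g = +-mono-≤ (f≤g zero) (∑-mono (f≤g ∘ suc))

term≤∑ : ∀ {N} (f : Fin N → ℕ) i → f i ≤ ∑[ j < N ] f j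
term≤∑ f zero    = m≤m+n (f zero) _
term≤∑ f (suc i) = ≤-trans (term≤∑ (f ∘ suc) i) (m≤n+m _ (f zero))

fibre-≤1 : ∀ {A : Set} {N} (_≟_ : DecidableEquality A) (g : Fin N → A) → Injective _≡_ _≡_ g →
           ∀ a → ∑[ i < N ] 𝟙 (does (g i ≟ a)) ≤ 1
fibre-≤1 {N = zero}  _≟_ g g-inj a = z≤n
fibre-≤1 {N = suc N} _≟_ g g-inj a with g zero ≟ a
... | yes g0≡a = ≤-reflexive (cong suc (∑-zero elsewhere))
  where
  elsewhere : ∀ i → 𝟙 (does (g (suc i) ≟ a)) ≡ 0
  elsewhere i with g (suc i) ≟ a
  ... | yes gi≡a = case g-inj (trans gi≡a (sym g0≡a)) of λ ()
  ... | no  _    = refl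
... | no  _    = fibre-≤1 _≟_ (g ∘ suc) (Fin.suc-injective ∘ g-inj) a

∑ᶜ : ∀ n → (Point n → ℕ) → ℕ
∑ᶜ zero    f = f []
∑ᶜ (suc n) f = ∑ᶜ n (f ∘ (false ∷_)) + ∑ᶜ n (f ∘ (true ∷_))

∑ᶜ-cong : ∀ n {f g : Point n → ℕ} → (∀ x → f x ≡ g x) → ∑ᶜ n f ≡ ∑ᶜ n g
∑ᶜ-cong zero    f≗g = f≗g []
∑ᶜ-cong (suc n) f≗g = cong₂ _+_ (∑ᶜ-cong n (f≗g ∘ (false ∷_))) (∑ᶜ-cong n (f≗g ∘ (true ∷_)))

∑ᶜ-mono : ∀ n {f g : Point n → ℕ} → (∀ x → f x ≤ g x) → ∑ᶜ n f ≤ ∑ᶜ n g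
∑ᶜ-mono zero    f≤g = f≤g []
∑ᶜ-mono (suc n) f≤g = +-mono-≤ (∑ᶜ-mono n (f≤g ∘ (false ∷_))) (∑ᶜ-mono n (f≤g ∘ (true ∷_)))

∑ᶜ-∣ : ∀ n {d} {f : Point n → ℕ} → (∀ x → d ∣ f x) → d ∣ ∑ᶜ n f
∑ᶜ-∣ zero    d∣f = d∣f []
∑ᶜ-∣ (suc n) d∣f = ∣m∣n⇒∣m+n (∑ᶜ-∣ n (d∣f ∘ (false ∷_))) (∑ᶜ-∣ n (d∣f ∘ (true ∷_)))

∑ᶜ-distrib-+ : ∀ n (f g : Point n → ℕ) → ∑ᶜ n (λ x → f x + g x) ≡ ∑ᶜ n f + ∑ᶜ n g
∑ᶜ-distrib-+ zero    f g = refl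
∑ᶜ-distrib-+ (suc n) f g = begin
  ∑ᶜ n (λ x → f₀ x + g₀ x) + ∑ᶜ n (λ x → f₁ x + g₁ x)
    ≡⟨ cong₂ _+_ (∑ᶜ-distrib-+ n f₀ g₀) (∑ᶜ-distrib-+ n f₁ g₁) ⟩
  (∑ᶜ n f₀ + ∑ᶜ n g₀) + (∑ᶜ n f₁ + ∑ᶜ n g₁)
    ≡⟨ +-interchange (∑ᶜ n f₀) (∑ᶜ n g₀) (∑ᶜ n f₁) (∑ᶜ n g₁) ⟩
  (∑ᶜ n f₀ + ∑ᶜ n f₁) + (∑ᶜ n g₀ + ∑ᶜ n g₁) ∎
  where
  open ≡-Reasoning
  f₀ = f ∘ (false ∷_); f₁ = f ∘ (true ∷_); g₀ = g ∘ (false ∷_); g₁ = g ∘ (true ∷_)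

∑ᶜ-*-distribˡ : ∀ n c (f : Point n → ℕ) → ∑ᶜ n (λ x → c * f x) ≡ c * ∑ᶜ n f
∑ᶜ-*-distribˡ zero    c f = refl
∑ᶜ-*-distribˡ (suc n) c f =
  trans (cong₂ _+_ (∑ᶜ-*-distribˡ n c _) (∑ᶜ-*-distribˡ n c _)) (sym (*-distribˡ-+ c _ _))

∑ᶜ-const : ∀ n c → ∑ᶜ n (λ _ → c) ≡ 2 ^ n * c
∑ᶜ-const zero    c = sym (+-identityʳ c)
∑ᶜ-const (suc n) c = begin
  ∑ᶜ n (λ _ → c) + ∑ᶜ n (λ _ → c)  ≡⟨ cong₂ _+_ (∑ᶜ-const n c) (∑ᶜ-const n c) ⟩
  2 ^ n * c + 2 ^ n * c            ≡⟨ *-distribʳ-+ c (2 ^ n) (2 ^ n) ⟨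
  (2 ^ n + 2 ^ n) * c              ≡⟨ cong (λ z → (2 ^ n + z) * c) (+-identityʳ (2 ^ n)) ⟨
  2 ^ suc n * c                    ∎
  where open ≡-Reasoning

∑ᶜ-zero : ∀ n → ∑ᶜ n (λ _ → 0) ≡ 0
∑ᶜ-zero n = trans (∑ᶜ-const n 0) (*-zeroʳ (2 ^ n))

∑ᶜ-∑-comm : ∀ n {N} (f : Fin N → Point n → ℕ) →
            ∑ᶜ n (λ x → ∑[ i < N ] f i x) ≡ ∑[ i < N ] ∑ᶜ n (f i)
∑ᶜ-∑-comm n {zero}  f = ∑ᶜ-zero n
∑ᶜ-∑-comm n {suc N} f =
  trans (∑ᶜ-distrib-+ n (f zero) _) (cong (∑ᶜ n (f zero) +_) (∑ᶜ-∑-comm n (f ∘ suc)))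

∑ᶜ-comm : ∀ n n′ (f : Point n → Point n′ → ℕ) →
          ∑ᶜ n (λ x → ∑ᶜ n′ (f x)) ≡ ∑ᶜ n′ (λ y → ∑ᶜ n (λ x → f x y))
∑ᶜ-comm zero    n′ f = refl
∑ᶜ-comm (suc n) n′ f = begin
  ∑ᶜ n (λ x → ∑ᶜ n′ (f (false ∷ x))) + ∑ᶜ n (λ x → ∑ᶜ n′ (f (true ∷ x)))
    ≡⟨ cong₂ _+_ (∑ᶜ-comm n n′ (f ∘ (false ∷_))) (∑ᶜ-comm n n′ (f ∘ (true ∷_))) ⟩
  ∑ᶜ n′ (λ y → ∑ᶜ n (λ x → f (false ∷ x) y)) + ∑ᶜ n′ (λ y → ∑ᶜ n (λ x → f (true ∷ x) y))
    ≡⟨ ∑ᶜ-distrib-+ n′ _ _ ⟨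
  ∑ᶜ n′ (λ y → ∑ᶜ (suc n) (λ x → f x y)) ∎
  where open ≡-Reasoning

_≟ᵛ_ : ∀ {n} → DecidableEquality (Vec Bool n)
_≟ᵛ_ = ≡-dec _≟_

_==_ : ∀ {n} → Vec Bool n → Vec Bool n → Bool
P == Q = does (P ≟ᵛ Q)

∑ᶜ-point : ∀ n (P : Point n) c → ∑ᶜ n (λ Q → 𝟙 (P == Q) * c) ≡ c
∑ᶜ-point zero    []          c = +-identityʳ c
∑ᶜ-point (suc n) (false ∷ P) c = trans (cong₂ _+_ (∑ᶜ-point n P c) (∑ᶜ-zero n)) (+-identityʳ c)
∑ᶜ-point (suc n) (true ∷ P)  c = cong₂ _+_ (∑ᶜ-zero n) (∑ᶜ-point n P c)

∑-by-fibres : ∀ {n N} (h : Fin N → Vec Bool n) (g : Fin N → ℕ) →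
              ∑ᶜ n (λ Q → ∑[ i < N ] (𝟙 (h i == Q) * g i)) ≡ ∑[ i < N ] g i
∑-by-fibres {n} {N} h g = trans (∑ᶜ-∑-comm n {N} _) (sum-cong-≗ (λ i → ∑ᶜ-point n (h i) (g i)))

∑ᶜ-subsets : ∀ {n} (T : Subset n) j → ∑ᶜ n (λ Q → 𝟙 (does (Q ⊆? T) ∧ does (∣ Q ∣ ≟ℕ j))) ≡ ∣ T ∣ C j
∑ᶜ-subsets []          zero    = refl
∑ᶜ-subsets []          (suc j) = refl
∑ᶜ-subsets {suc n} (false ∷ T) j = trans (cong₂ _+_ (∑ᶜ-subsets T j) (∑ᶜ-zero n)) (+-identityʳ _)
∑ᶜ-subsets {suc n} (true ∷ T)  zero =
  cong₂ _+_ (∑ᶜ-subsets T zero) (trans (∑ᶜ-cong n (λ Q → cong 𝟙 (∧-zeroʳ _))) (∑ᶜ-zero n))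
∑ᶜ-subsets (true ∷ T) (suc j) =
  trans (cong₂ _+_ (∑ᶜ-subsets T (suc j)) (∑ᶜ-subsets T j))
        (trans (+-comm (∣ T ∣ C suc j) (∣ T ∣ C j)) (nCk+nC[k+1]≡[n+1]C[k+1] ∣ T ∣ j))

∑ᶜ-size : ∀ n j → ∑ᶜ n (λ Q → 𝟙 (does (∣ Q ∣ ≟ℕ j))) ≡ n C j
∑ᶜ-size n j = begin
  ∑ᶜ n (λ Q → 𝟙 (does (∣ Q ∣ ≟ℕ j)))
    ≡⟨ ∑ᶜ-cong n (λ Q → cong (λ z → 𝟙 (z ∧ does (∣ Q ∣ ≟ℕ j))) (dec-true (Q ⊆? ⊤) ⊆⊤)) ⟨
  ∑ᶜ n (λ Q → 𝟙 (does (Q ⊆? ⊤) ∧ does (∣ Q ∣ ≟ℕ j)))  ≡⟨ ∑ᶜ-subsets (⊤ {n}) j ⟩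
  ∣ ⊤ {n} ∣ C j                                       ≡⟨ cong (_C j) (∣⊤∣≡n n) ⟩
  n C j                                               ∎
  where open ≡-Reasoning

⊆∧∣≡∣⇒≡ : ∀ {n} {p q : Subset n} → p ⊆ q → ∣ p ∣ ≡ ∣ q ∣ → p ≡ q
⊆∧∣≡∣⇒≡ {p = []}          {[]}        _   _         = refl
⊆∧∣≡∣⇒≡ {p = true ∷ p}  {true ∷ q}  p⊆q ∣p∣≡∣q∣ =
  cong (true ∷_) (⊆∧∣≡∣⇒≡ (drop-∷-⊆ p⊆q) (suc-injective ∣p∣≡∣q∣))
⊆∧∣≡∣⇒≡ {p = false ∷ p} {false ∷ q} p⊆q ∣p∣≡∣q∣ = cong (false ∷_) (⊆∧∣≡∣⇒≡ (drop-∷-⊆ p⊆q) ∣p∣≡∣q∣)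
⊆∧∣≡∣⇒≡ {p = false ∷ p} {true ∷ q}  p⊆q ∣p∣≡∣q∣ =
  contradiction (p⊆q⇒∣p∣≤∣q∣ (drop-∷-⊆ p⊆q)) (<⇒≱ (≤-reflexive (sym ∣p∣≡∣q∣)))
⊆∧∣≡∣⇒≡ {p = true ∷ p}  {false ∷ q} p⊆q _ = case p⊆q here of λ ()

∣p∣<n⇒∁p≢∅ : ∀ {n} (p : Subset n) → ∣ p ∣ < n → ∁ p ≢ ∅
∣p∣<n⇒∁p≢∅ {n} p ∣p∣<n ∁p≡∅ =
  <⇒≱ ∣p∣<n (m∸n≡0⇒m≤n (trans (sym (∣∁p∣≡n∸∣p∣ p)) (trans (cong ∣_∣ ∁p≡∅) (∣⊥∣≡0 n))))

-- Characters of the cube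

parity : ∀ {n} → Subset n → Point n → Bool
parity []      []       = false
parity (u ∷ U) (x ∷ xs) = (u ∧ x) xor parity U xs

parity-∅ : ∀ {n} (x : Point n) → parity ∅ x ≡ false
parity-∅ []       = refl
parity-∅ (x ∷ xs) = parity-∅ xs

isOdd : ℕ → Bool
isOdd zero    = false
isOdd (suc n) = not (isOdd n)

parity-⊤ : ∀ {n} (U : Subset n) → parity U ⊤ ≡ isOdd ∣ U ∣
parity-⊤ []          = refl
parity-⊤ (true ∷ U)  = cong not (parity-⊤ U)
parity-⊤ (false ∷ U) = parity-⊤ U

not-≟ : ∀ a b → does (not a ≟ b) ≡ does (a ≟ not b)
not-≟ true  true  = refl
not-≟ true  false = refl
not-≟ false true  = refl
not-≟ false false = refl

parity-balanced : ∀ {n} (U : Subset n) → U ≢ ∅ →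
                  ∑ᶜ n (λ x → 𝟙 (does (parity U x ≟ true))) ≡ ∑ᶜ n (λ x → 𝟙 (does (parity U x ≟ false)))
parity-balanced []          []≢∅ = contradiction refl []≢∅
parity-balanced {suc n} (true ∷ U) _ = begin
  E true + F true    ≡⟨ cong (E true +_) (flipped true) ⟩
  E true + E false   ≡⟨ +-comm (E true) (E false) ⟩
  E false + E true   ≡⟨ cong (E false +_) (flipped false) ⟨
  E false + F false  ∎
  where
  open ≡-Reasoning
  E F : Bool → ℕ
  E b = ∑ᶜ n (λ x → 𝟙 (does (parity U x ≟ b)))
  F b = ∑ᶜ n (λ x → 𝟙 (does (not (parity U x) ≟ b)))
  flipped : ∀ b → F b ≡ E (not b)
  flipped b = ∑ᶜ-cong n (λ x → cong 𝟙 (not-≟ (parity U x) b))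
parity-balanced (false ∷ U) U≢∅ = cong₂ _+_ balanced balanced
  where balanced = parity-balanced U (U≢∅ ∘ cong (false ∷_))

parity-shift-balanced : ∀ {n} (U : Subset n) → U ≢ ∅ → ∀ p →
  ∑ᶜ n (λ x → 𝟙 (does (p xor parity U x ≟ true))) ≡ ∑ᶜ n (λ x → 𝟙 (does (p xor parity U x ≟ false)))
parity-shift-balanced     U U≢∅ false = parity-balanced U U≢∅
parity-shift-balanced {n} U U≢∅ true  =
  trans (flipped true) (trans (sym (parity-balanced U U≢∅)) (sym (flipped false)))
  where
  flipped : ∀ b → ∑ᶜ n (λ x → 𝟙 (does (not (parity U x) ≟ b))) ≡ ∑ᶜ n (λ x → 𝟙 (does (parity U x ≟ not b)))
  flipped b = ∑ᶜ-cong n (λ x → cong 𝟙 (not-≟ (parity U x) b))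

parity-total : ∀ {n} (U : Subset n) →
  ∑ᶜ n (λ x → 𝟙 (does (parity U x ≟ true))) + ∑ᶜ n (λ x → 𝟙 (does (parity U x ≟ false))) ≡ 2 ^ n
parity-total {n} U = begin
  ∑ᶜ n (λ x → 𝟙 (does (parity U x ≟ true))) + ∑ᶜ n (λ x → 𝟙 (does (parity U x ≟ false)))
    ≡⟨ ∑ᶜ-distrib-+ n _ _ ⟨
  ∑ᶜ n (λ x → 𝟙 (does (parity U x ≟ true)) + 𝟙 (does (parity U x ≟ false)))
    ≡⟨ ∑ᶜ-cong n (λ x → 𝟙-split true (parity U x)) ⟩
  ∑ᶜ n (λ _ → 1)
    ≡⟨ trans (∑ᶜ-const n 1) (*-identityʳ (2 ^ n)) ⟩
  2 ^ n ∎
  where open ≡-Reasoning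

-- Faces as subcubes

isStar : Sym → Bool
isStar star = true
isStar c0   = false
isStar c1   = false

isOne : Sym → Bool
isOne c1   = true
isOne c0   = false
isOne star = false

starSet : ∀ {n} → Tuple n → Subset n
starSet = map isStar

corner : ∀ {n} → Tuple n → Point n
corner = map isOne

∣starSet∣≡stars : ∀ {n} (t : Tuple n) → ∣ starSet t ∣ ≡ stars t
∣starSet∣≡stars []         = refl
∣starSet∣≡stars (c0 ∷ t)   = ∣starSet∣≡stars t
∣starSet∣≡stars (c1 ∷ t)   = ∣starSet∣≡stars t
∣starSet∣≡stars (star ∷ t) = cong suc (∣starSet∣≡stars t)

_∈ᵇ_ : ∀ {n} → Point n → Tuple n → Bool
[]       ∈ᵇ []         = true
(x ∷ xs) ∈ᵇ (c0 ∷ t)   = not x ∧ xs ∈ᵇ t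
(x ∷ xs) ∈ᵇ (c1 ∷ t)   = x ∧ xs ∈ᵇ t
(x ∷ xs) ∈ᵇ (star ∷ t) = xs ∈ᵇ t

∈F⇒∈ᵇ : ∀ {n} (x : Point n) (t : Tuple n) → x ∈F t → x ∈ᵇ t ≡ true
∈F⇒∈ᵇ []       []         _   = refl
∈F⇒∈ᵇ (x ∷ xs) (c0 ∷ t)   x∈t rewrite x∈t zero = ∈F⇒∈ᵇ xs t (x∈t ∘ suc)
∈F⇒∈ᵇ (x ∷ xs) (c1 ∷ t)   x∈t rewrite x∈t zero = ∈F⇒∈ᵇ xs t (x∈t ∘ suc)
∈F⇒∈ᵇ (x ∷ xs) (star ∷ t) x∈t = ∈F⇒∈ᵇ xs t (x∈t ∘ suc)

-- The face t is a copy of Q_2^(stars t): embed t fills in its star positions, and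
-- restrict U t is the trace of U on them.

embed : ∀ {n} (t : Tuple n) → Point (stars t) → Point n
embed []         []      = []
embed (c0 ∷ t)   y       = false ∷ embed t y
embed (c1 ∷ t)   y       = true ∷ embed t y
embed (star ∷ t) (b ∷ y) = b ∷ embed t y

restrict : ∀ {n} → Subset n → (t : Tuple n) → Subset (stars t)
restrict []      []         = []
restrict (u ∷ U) (c0 ∷ t)   = restrict U t
restrict (u ∷ U) (c1 ∷ t)   = restrict U t
restrict (u ∷ U) (star ∷ t) = u ∷ restrict U t

∑ᶜ-face : ∀ {n} (t : Tuple n) (P : Point n → Bool) →
          ∑ᶜ n (λ x → 𝟙 (x ∈ᵇ t ∧ P x)) ≡ ∑ᶜ (stars t) (λ y → 𝟙 (P (embed t y)))
∑ᶜ-face []                 P = refl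
∑ᶜ-face {suc n} (c0 ∷ t)   P = trans (cong₂ _+_ (∑ᶜ-face t (P ∘ (false ∷_))) (∑ᶜ-zero n)) (+-identityʳ _)
∑ᶜ-face {suc n} (c1 ∷ t)   P = cong₂ _+_ (∑ᶜ-zero n) (∑ᶜ-face t (P ∘ (true ∷_)))
∑ᶜ-face         (star ∷ t) P = cong₂ _+_ (∑ᶜ-face t (P ∘ (false ∷_))) (∑ᶜ-face t (P ∘ (true ∷_)))

xor-interchange : ∀ a b c → a xor (b xor c) ≡ b xor (a xor c)
xor-interchange a b c = trans (sym (xor-assoc a b c)) (trans (cong (_xor c) (xor-comm a b)) (xor-assoc b a c))

parity-embed : ∀ {n} (U : Subset n) (t : Tuple n) y →
               parity U (embed t y) ≡ parity U (corner t) xor parity (restrict U t) y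
parity-embed []      []         []      = refl
parity-embed (u ∷ U) (c0 ∷ t)   y       =
  trans (cong ((u ∧ false) xor_) (parity-embed U t y)) (sym (xor-assoc (u ∧ false) _ _))
parity-embed (u ∷ U) (c1 ∷ t)   y       =
  trans (cong ((u ∧ true) xor_) (parity-embed U t y)) (sym (xor-assoc (u ∧ true) _ _))
parity-embed (u ∷ U) (star ∷ t) (b ∷ y) = begin
  (u ∧ b) xor parity U (embed t y)
    ≡⟨ cong ((u ∧ b) xor_) (parity-embed U t y) ⟩
  (u ∧ b) xor (c xor parity V y)
    ≡⟨ xor-interchange (u ∧ b) c (parity V y) ⟩
  c xor ((u ∧ b) xor parity V y)
    ≡⟨ cong (λ z → (z xor c) xor ((u ∧ b) xor parity V y)) (∧-zeroʳ u) ⟨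
  ((u ∧ false) xor c) xor ((u ∧ b) xor parity V y) ∎
  where
  open ≡-Reasoning
  c = parity U (corner t)
  V = restrict U t

pointsOfParity : ∀ {n} → Subset n → Bool → Tuple n → ℕ
pointsOfParity {n} U b t = ∑ᶜ n (λ x → 𝟙 (x ∈ᵇ t ∧ does (parity U x ≟ b)))

pointsOfParity-embed : ∀ {n} (U : Subset n) b t → pointsOfParity U b t ≡
  ∑ᶜ (stars t) (λ y → 𝟙 (does (parity U (corner t) xor parity (restrict U t) y ≟ b)))
pointsOfParity-embed U b t =
  trans (∑ᶜ-face t _) (∑ᶜ-cong (stars t) (λ y → cong (λ z → 𝟙 (does (z ≟ b))) (parity-embed U t y)))

pointsOfParity-total : ∀ {n} (U : Subset n) t → pointsOfParity U true t + pointsOfParity U false t ≡ 2 ^ stars t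
pointsOfParity-total U t = begin
  pointsOfParity U true t + pointsOfParity U false t
    ≡⟨ cong₂ _+_ (pointsOfParity-embed U true t) (pointsOfParity-embed U false t) ⟩
  ∑ᶜ s (λ y → 𝟙 (does (z y ≟ true))) + ∑ᶜ s (λ y → 𝟙 (does (z y ≟ false)))
    ≡⟨ ∑ᶜ-distrib-+ s _ _ ⟨
  ∑ᶜ s (λ y → 𝟙 (does (z y ≟ true)) + 𝟙 (does (z y ≟ false)))
    ≡⟨ ∑ᶜ-cong s (λ y → 𝟙-split true (z y)) ⟩
  ∑ᶜ s (λ _ → 1)
    ≡⟨ trans (∑ᶜ-const s 1) (*-identityʳ (2 ^ s)) ⟩
  2 ^ s ∎
  where
  open ≡-Reasoning
  s = stars t
  z = λ y → parity U (corner t) xor parity (restrict U t) y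

pointsOfParity-inside : ∀ {n} (U : Subset n) b t → restrict U t ≡ ∅ →
  pointsOfParity U b t ≡ 2 ^ stars t * 𝟙 (does (parity U (corner t) ≟ b))
pointsOfParity-inside U b t U∩t≡∅ =
  trans (pointsOfParity-embed U b t) (trans (∑ᶜ-cong (stars t) constant) (∑ᶜ-const (stars t) _))
  where
  p = parity U (corner t)
  constant : ∀ y → 𝟙 (does (p xor parity (restrict U t) y ≟ b)) ≡ 𝟙 (does (p ≟ b))
  constant y = cong (λ z → 𝟙 (does (z ≟ b)))
    (trans (cong (λ V → p xor parity V y) U∩t≡∅) (trans (cong (p xor_) (parity-∅ y)) (xor-identityʳ p)))

pointsOfParity-straddling : ∀ {n} (U : Subset n) t → restrict U t ≢ ∅ →
  pointsOfParity U true t ≡ pointsOfParity U false t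
pointsOfParity-straddling U t U∩t≢∅ =
  trans (pointsOfParity-embed U true t)
    (trans (parity-shift-balanced (restrict U t) U∩t≢∅ (parity U (corner t))) (sym (pointsOfParity-embed U false t)))

restrict∁≟∅≡starSet⊆? : ∀ {n} (T : Subset n) (t : Tuple n) → does (restrict (∁ T) t ≟ᵛ ∅) ≡ does (starSet t ⊆? T)
restrict∁≟∅≡starSet⊆? []          []         = refl
restrict∁≟∅≡starSet⊆? (x ∷ T)     (c0 ∷ t)   = restrict∁≟∅≡starSet⊆? T t
restrict∁≟∅≡starSet⊆? (x ∷ T)     (c1 ∷ t)   = restrict∁≟∅≡starSet⊆? T t
restrict∁≟∅≡starSet⊆? (true ∷ T)  (star ∷ t) = restrict∁≟∅≡starSet⊆? T t
restrict∁≟∅≡starSet⊆? (false ∷ T) (star ∷ t) = refl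

starSet⊆⇒restrict∁≡∅ : ∀ {n} (T : Subset n) t → starSet t ⊆ T → restrict (∁ T) t ≡ ∅
starSet⊆⇒restrict∁≡∅ T t t⊆T with restrict (∁ T) t ≟ᵛ ∅ | restrict∁≟∅≡starSet⊆? T t
... | yes r≡∅ | _  = r≡∅
... | no  _   | eq = case trans eq (dec-true (starSet t ⊆? T) t⊆T) of λ ()

straddlingPoints : ∀ {n} → Subset n → Tuple n → ℕ
straddlingPoints U t = if does (restrict U t ≟ᵛ ∅) then 0 else pointsOfParity U true t

pointsOfParity-split : ∀ {n} (U : Subset n) b t → pointsOfParity U b t ≡
  straddlingPoints U t + 2 ^ stars t * 𝟙 (does (restrict U t ≟ᵛ ∅) ∧ does (parity U (corner t) ≟ b))
pointsOfParity-split U b t with restrict U t ≟ᵛ ∅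
... | yes U∩t≡∅ = pointsOfParity-inside U b t U∩t≡∅
... | no  U∩t≢∅ = trans (straddling b) (sym (trans (cong (pointsOfParity U true t +_) (*-zeroʳ (2 ^ stars t))) (+-identityʳ _)))
  where
  straddling : ∀ b → pointsOfParity U b t ≡ pointsOfParity U true t
  straddling true  = refl
  straddling false = sym (pointsOfParity-straddling U t U∩t≢∅)

-- Coverings by faces of equal dimension

m+n≡o+o⇒o≤m⇒o≤n⇒m≡n : ∀ {a b c} → a + b ≡ c + c → c ≤ a → c ≤ b → a ≡ b
m+n≡o+o⇒o≤m⇒o≤n⇒m≡n {a} {b} {c} a+b≡c+c c≤a c≤b = trans (≤-antisym a≤c c≤a) (≤-antisym c≤b b≤c)
  where
  a≤c : a ≤ c
  a≤c = +-cancelʳ-≤ c a c (≤-trans (+-monoʳ-≤ a c≤b) (≤-reflexive a+b≡c+c))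
  b≤c : b ≤ c
  b≤c = +-cancelˡ-≤ c b c (≤-trans (+-monoˡ-≤ b c≤a) (≤-reflexive a+b≡c+c))

module _ {n m N : ℕ} (face : Fin N → Tuple n) (dim : ∀ i → stars (face i) ≡ m)
         (volume : N * 2 ^ m ≡ 2 ^ n) (covers : ∀ x → ∃ λ i → x ∈F face i) where

  coveredPoints : Subset n → Bool → ℕ
  coveredPoints U b = ∑[ i < N ] pointsOfParity U b (face i)

  parityClass≤coveredPoints : ∀ U b → ∑ᶜ n (λ x → 𝟙 (does (parity U x ≟ b))) ≤ coveredPoints U b
  parityClass≤coveredPoints U b = ≤-trans (∑ᶜ-mono n covered) (≤-reflexive (∑ᶜ-∑-comm n {N} _))
    where
    covered : ∀ x → 𝟙 (does (parity U x ≟ b)) ≤ ∑[ i < N ] 𝟙 (x ∈ᵇ face i ∧ does (parity U x ≟ b))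
    covered x with covers x
    ... | i , x∈i = ≤-trans (≤-reflexive (cong (λ z → 𝟙 (z ∧ does (parity U x ≟ b))) (sym (∈F⇒∈ᵇ x (face i) x∈i))))
                            (term≤∑ (λ j → 𝟙 (x ∈ᵇ face j ∧ does (parity U x ≟ b))) i)

  coveredPoints-total : ∀ U → coveredPoints U true + coveredPoints U false ≡ 2 ^ n
  coveredPoints-total U = begin
    coveredPoints U true + coveredPoints U false   ≡⟨ ∑-distrib-+ (λ i → pointsOfParity U true (face i)) _ ⟨
    ∑[ i < N ] (pointsOfParity U true (face i) + pointsOfParity U false (face i))
                                                   ≡⟨ sum-cong-≗ (λ i → trans (pointsOfParity-total U (face i)) (cong (2 ^_) (dim i))) ⟩
    ∑[ i < N ] (2 ^ m)                             ≡⟨ ∑-const N (2 ^ m) ⟩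
    N * 2 ^ m                                      ≡⟨ volume ⟩
    2 ^ n                                          ∎
    where open ≡-Reasoning

  -- Both U-parity classes of the cube have 2^(n-1) points, and the covering has total volume
  -- 2^n, so it meets each class exactly as often as the class has points.
  coveredPoints-balanced : ∀ U → U ≢ ∅ → coveredPoints U true ≡ coveredPoints U false
  coveredPoints-balanced U U≢∅ = m+n≡o+o⇒o≤m⇒o≤n⇒m≡n
    (trans (coveredPoints-total U) (sym (trans (cong (E true +_) (parity-balanced U U≢∅)) (parity-total U))))
    (parityClass≤coveredPoints U true) (≤-trans (≤-reflexive (parity-balanced U U≢∅)) (parityClass≤coveredPoints U false))
    where
    E : Bool → ℕ
    E b = ∑ᶜ n (λ x → 𝟙 (does (parity U x ≟ b)))

  coveredPoints-split : ∀ U b → coveredPoints U b ≡ ∑[ i < N ] straddlingPoints U (face i) +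
    2 ^ m * ∑[ i < N ] 𝟙 (does (restrict U (face i) ≟ᵛ ∅) ∧ does (parity U (corner (face i)) ≟ b))
  coveredPoints-split U b = begin
    coveredPoints U b
      ≡⟨ sum-cong-≗ (λ i → trans (pointsOfParity-split U b (face i)) (cong (λ s → straddlingPoints U (face i) + 2 ^ s * inside i) (dim i))) ⟩
    ∑[ i < N ] (straddlingPoints U (face i) + 2 ^ m * inside i)
      ≡⟨ ∑-distrib-+ (λ i → straddlingPoints U (face i)) _ ⟩
    ∑[ i < N ] straddlingPoints U (face i) + ∑[ i < N ] (2 ^ m * inside i)
      ≡⟨ cong (∑[ i < N ] straddlingPoints U (face i) +_) (*-distribˡ-sum {N} (2 ^ m) inside) ⟨
    ∑[ i < N ] straddlingPoints U (face i) + 2 ^ m * ∑[ i < N ] inside i ∎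
    where
    open ≡-Reasoning
    inside : Fin N → ℕ
    inside i = 𝟙 (does (restrict U (face i) ≟ᵛ ∅) ∧ does (parity U (corner (face i)) ≟ b))

  -- A face meeting U in a star position lies evenly in both classes, so the others are balanced too.
  covering-balanced : ∀ (U : Subset n) → U ≢ ∅ →
    ∑[ i < N ] 𝟙 (does (restrict U (face i) ≟ᵛ ∅) ∧ does (parity U (corner (face i)) ≟ true)) ≡
    ∑[ i < N ] 𝟙 (does (restrict U (face i) ≟ᵛ ∅) ∧ does (parity U (corner (face i)) ≟ false))
  covering-balanced U U≢∅ =
    *-cancelˡ-≡ _ _ (2 ^ m) {{m^n≢0 2 m}} (+-cancelˡ-≡ (∑[ i < N ] straddlingPoints U (face i)) _ _
      (trans (sym (coveredPoints-split U true)) (trans (coveredPoints-balanced U U≢∅) (coveredPoints-split U false))))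

  covering-balanced-⊆ : ∀ (T : Subset n) → ∁ T ≢ ∅ →
    ∑[ i < N ] 𝟙 (does (starSet (face i) ⊆? T) ∧ does (parity (∁ T) (corner (face i)) ≟ true)) ≡
    ∑[ i < N ] 𝟙 (does (starSet (face i) ⊆? T) ∧ does (parity (∁ T) (corner (face i)) ≟ false))
  covering-balanced-⊆ T ∁T≢∅ = trans (sym (inside≡⊆ true)) (trans (covering-balanced (∁ T) ∁T≢∅) (inside≡⊆ false))
    where
    inside≡⊆ : ∀ b →
      ∑[ i < N ] 𝟙 (does (restrict (∁ T) (face i) ≟ᵛ ∅) ∧ does (parity (∁ T) (corner (face i)) ≟ b)) ≡
      ∑[ i < N ] 𝟙 (does (starSet (face i) ⊆? T) ∧ does (parity (∁ T) (corner (face i)) ≟ b))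
    inside≡⊆ b = sum-cong-≗ (λ i → cong (λ z → 𝟙 (z ∧ does (parity (∁ T) (corner (face i)) ≟ b)))
                                         (restrict∁≟∅≡starSet⊆? T (face i)))

-- Antipodal faces

antipode : ∀ {n} → Tuple n → Tuple n
antipode = map flipS

_≟ˢ_ : DecidableEquality Sym
c0   ≟ˢ c0   = yes refl
c1   ≟ˢ c1   = yes refl
star ≟ˢ star = yes refl
c0   ≟ˢ c1   = no λ ()
c0   ≟ˢ star = no λ ()
c1   ≟ˢ c0   = no λ ()
c1   ≟ˢ star = no λ ()
star ≟ˢ c0   = no λ ()
star ≟ˢ c1   = no λ ()

_≟ᵗ_ : ∀ {n} → DecidableEquality (Tuple n)
_≟ᵗ_ = ≡-dec _≟ˢ_

lookup-ext : ∀ {A : Set} {n} (xs ys : Vec A n) → (∀ i → lookup xs i ≡ lookup ys i) → xs ≡ ys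
lookup-ext xs ys xs≗ys = trans (sym (tabulate∘lookup xs)) (trans (tabulate-cong xs≗ys) (tabulate∘lookup ys))

Antipodal⇒≡antipode : ∀ {n} (a b : Tuple n) → Antipodal a b → b ≡ antipode a
Antipodal⇒≡antipode a b (a∥b , flipped) =
  lookup-ext b (antipode a) (λ i → trans (entry i (lookup a i) refl) (sym (lookup-map i flipS a)))
  where
  entry : ∀ i s → lookup a i ≡ s → lookup b i ≡ flipS s
  entry i star a≡s = proj₁ (a∥b i) a≡s
  entry i c0   a≡s = trans (flipped i (λ a≡* → case trans (sym a≡s) a≡* of λ ())) (cong flipS a≡s)
  entry i c1   a≡s = trans (flipped i (λ a≡* → case trans (sym a≡s) a≡* of λ ())) (cong flipS a≡s)

isStar-≡⇒star : ∀ s s′ → isStar s ≡ isStar s′ → s ≡ star → s′ ≡ star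
isStar-≡⇒star star star _ _ = refl

starSet-≡⇒Parallel : ∀ {n} (a b : Tuple n) → starSet a ≡ starSet b → Parallel a b
starSet-≡⇒Parallel a b a≡b i =
  isStar-≡⇒star (lookup a i) (lookup b i) same , isStar-≡⇒star (lookup b i) (lookup a i) (sym same)
  where
  same : isStar (lookup a i) ≡ isStar (lookup b i)
  same = trans (sym (lookup-map i isStar a)) (trans (cong (λ v → lookup v i) a≡b) (lookup-map i isStar b))

xor-not-not : ∀ a b → not a xor not b ≡ a xor b
xor-not-not true  b = refl
xor-not-not false b = not-involutive b

parity-antipode : ∀ {n} (U : Subset n) (t : Tuple n) → restrict U t ≡ ∅ →
                  parity U (corner (antipode t)) ≡ parity U (corner t) xor parity U ⊤
parity-antipode []          []         _     = refl
parity-antipode (false ∷ U) (c0 ∷ t)   U∩t≡∅ = parity-antipode U t U∩t≡∅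
parity-antipode (true ∷ U)  (c0 ∷ t)   U∩t≡∅ =
  trans (cong not (parity-antipode U t U∩t≡∅)) (not-distribʳ-xor (parity U (corner t)) (parity U ⊤))
parity-antipode (false ∷ U) (c1 ∷ t)   U∩t≡∅ = parity-antipode U t U∩t≡∅
parity-antipode (true ∷ U)  (c1 ∷ t)   U∩t≡∅ =
  trans (parity-antipode U t U∩t≡∅) (sym (xor-not-not (parity U (corner t)) (parity U ⊤)))
parity-antipode (false ∷ U) (star ∷ t) U∩t≡∅ = parity-antipode U t (proj₂ (∷-injective U∩t≡∅))
parity-antipode (true ∷ U)  (star ∷ t) ()

-- Antipodal splittings

module _ {n k : ℕ} (S : AntipodalSplitting n k) where
  open AntipodalSplitting S

  ∣starSet∣≡m : ∀ i → ∣ starSet (face i) ∣ ≡ m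
  ∣starSet∣≡m i = trans (∣starSet∣≡stars (face i)) (isFace i)

  volume : 2 ^ k * 2 ^ m ≡ 2 ^ n
  volume = trans (sym (^-distribˡ-+-* 2 k m)) (cong (2 ^_) dim)

  sameStarSet⇒≡⊎antipode : ∀ i j → starSet (face j) ≡ starSet (face i) →
                           face j ≡ face i ⊎ face j ≡ antipode (face i)
  sameStarSet⇒≡⊎antipode i j sj≡si with face j ≟ᵗ face i
  ... | yes fj≡fi = inj₁ fj≡fi
  ... | no  fj≢fi = inj₂ (Antipodal⇒≡antipode (face i) (face j)
                           (antipodal i j (fj≢fi ∘ sym) (starSet-≡⇒Parallel (face i) (face j) (sym sj≡si))))

  multiplicity : Subset n → ℕ
  multiplicity Q = ∑[ i < 2 ^ k ] 𝟙 (starSet (face i) == Q)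

  ∑ᶜ-multiplicity : ∑ᶜ n multiplicity ≡ 2 ^ k
  ∑ᶜ-multiplicity = begin
    ∑ᶜ n multiplicity
      ≡⟨ ∑ᶜ-cong n (λ Q → sum-cong-≗ {2 ^ k} (λ i → *-identityʳ (𝟙 (starSet (face i) == Q)))) ⟨
    ∑ᶜ n (λ Q → ∑[ i < 2 ^ k ] (𝟙 (starSet (face i) == Q) * 1))  ≡⟨ ∑-by-fibres (starSet ∘ face) (λ _ → 1) ⟩
    ∑[ i < 2 ^ k ] 1                                              ≡⟨ trans (∑-const (2 ^ k) 1) (*-identityʳ (2 ^ k)) ⟩
    2 ^ k                                                         ∎
    where open ≡-Reasoning

  multiplicity-unoccupied : ∀ Q → ¬ (∃ λ i → starSet (face i) ≡ Q) → multiplicity Q ≡ 0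
  multiplicity-unoccupied Q unoccupied =
    ∑-zero (λ i → cong 𝟙 (dec-false (starSet (face i) ≟ᵛ Q) (λ si≡Q → unoccupied (i , si≡Q))))

  multiplicity-≤ : ∀ Q → multiplicity Q ≤ 2 * 𝟙 (does (∣ Q ∣ ≟ℕ m))
  multiplicity-≤ Q with any? (λ i → starSet (face i) ≟ᵛ Q)
  ... | no  unoccupied = ≤-trans (≤-reflexive (multiplicity-unoccupied Q unoccupied)) z≤n
  ... | yes (i , refl) = begin
    multiplicity (starSet (face i))
      ≤⟨ ∑-mono twoFaces ⟩
    ∑[ j < 2 ^ k ] (𝟙 (does (face j ≟ᵗ face i)) + 𝟙 (does (face j ≟ᵗ antipode (face i))))
      ≡⟨ ∑-distrib-+ (λ j → 𝟙 (does (face j ≟ᵗ face i))) _ ⟩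
    ∑[ j < 2 ^ k ] 𝟙 (does (face j ≟ᵗ face i)) + ∑[ j < 2 ^ k ] 𝟙 (does (face j ≟ᵗ antipode (face i)))
      ≤⟨ +-mono-≤ (fibre-≤1 _≟ᵗ_ face injective (face i)) (fibre-≤1 _≟ᵗ_ face injective (antipode (face i))) ⟩
    2 * 1
      ≡⟨ cong (λ z → 2 * 𝟙 z) (dec-true (∣ starSet (face i) ∣ ≟ℕ m) (∣starSet∣≡m i)) ⟨
    2 * 𝟙 (does (∣ starSet (face i) ∣ ≟ℕ m)) ∎
    where
    open ≤-Reasoning
    twoFaces : ∀ j → 𝟙 (starSet (face j) == starSet (face i)) ≤
                     𝟙 (does (face j ≟ᵗ face i)) + 𝟙 (does (face j ≟ᵗ antipode (face i)))
    twoFaces j with starSet (face j) ≟ᵛ starSet (face i)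
    ... | no  _     = z≤n
    ... | yes sj≡si with sameStarSet⇒≡⊎antipode i j sj≡si
    ...   | inj₁ fj≡fi = ≤-trans (≤-reflexive (cong 𝟙 (sym (dec-true (face j ≟ᵗ face i) fj≡fi)))) (m≤m+n _ _)
    ...   | inj₂ fj≡f̄i = ≤-trans (≤-reflexive (cong 𝟙 (sym (dec-true (face j ≟ᵗ antipode (face i)) fj≡f̄i)))) (m≤n+m _ _)

  splitting-bound : 2 ^ k ≤ 2 * (n C m)
  splitting-bound = begin
    2 ^ k                                       ≡⟨ ∑ᶜ-multiplicity ⟨
    ∑ᶜ n multiplicity                           ≤⟨ ∑ᶜ-mono n multiplicity-≤ ⟩
    ∑ᶜ n (λ Q → 2 * 𝟙 (does (∣ Q ∣ ≟ℕ m)))      ≡⟨ ∑ᶜ-*-distribˡ n 2 _ ⟩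
    2 * ∑ᶜ n (λ Q → 𝟙 (does (∣ Q ∣ ≟ℕ m)))      ≡⟨ cong (2 *_) (∑ᶜ-size n m) ⟩
    2 * (n C m)                                 ∎
    where open ≤-Reasoning

  parityMultiplicity : Subset n → Bool → Subset n → ℕ
  parityMultiplicity U b Q = ∑[ i < 2 ^ k ] 𝟙 (starSet (face i) == Q ∧ does (parity U (corner (face i)) ≟ b))

  multiplicity-split : ∀ U Q → multiplicity Q ≡ parityMultiplicity U true Q + parityMultiplicity U false Q
  multiplicity-split U Q =
    trans (sum-cong-≗ (λ i → sym (𝟙-split (starSet (face i) == Q) (parity U (corner (face i))))))
          (∑-distrib-+ (λ i → 𝟙 (starSet (face i) == Q ∧ does (parity U (corner (face i)) ≟ true))) _)

  parityMultiplicity-≤ : ∀ U b Q → parityMultiplicity U b Q ≤ multiplicity Q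
  parityMultiplicity-≤ U true  Q = ≤-trans (m≤m+n _ _) (≤-reflexive (sym (multiplicity-split U Q)))
  parityMultiplicity-≤ U false Q = ≤-trans (m≤n+m _ _) (≤-reflexive (sym (multiplicity-split U Q)))

  facesInside : Subset n → ℕ
  facesInside T = ∑ᶜ n (λ Q → 𝟙 (does (Q ⊆? T)) * multiplicity Q)

  module _ (0<k : 0 < k) where

    -- Only faces whose star set is Q miss ∁ Q, so covering-balanced splits them into equal halves.
    multiplicity-even : ∀ Q → 2 ∣ multiplicity Q
    multiplicity-even Q with any? (λ i → starSet (face i) ≟ᵛ Q)
    ... | no  unoccupied = subst (2 ∣_) (sym (multiplicity-unoccupied Q unoccupied)) (2 ∣0)
    ... | yes (i , refl) = divides (ofParity true) (begin
      multiplicity Q                  ≡⟨ multiplicity-split (∁ Q) Q ⟩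
      ofParity true + ofParity false  ≡⟨ cong (ofParity true +_) balanced ⟨
      ofParity true + ofParity true   ≡⟨ m+m≡m*2 (ofParity true) ⟩
      ofParity true * 2               ∎)
      where
      open ≡-Reasoning
      ofParity : Bool → ℕ
      ofParity b = parityMultiplicity (∁ Q) b Q
      ∁Q≢∅ : ∁ Q ≢ ∅
      ∁Q≢∅ = ∣p∣<n⇒∁p≢∅ Q (subst (_< n) (sym (∣starSet∣≡m i)) (subst (m <_) dim (m<n+m m 0<k)))
      ⊆Q≡==Q : ∀ j → does (starSet (face j) ⊆? Q) ≡ starSet (face j) == Q
      ⊆Q≡==Q j = does-⇔ (mk⇔ ⊆⇒≡ ⊆-reflexive) (starSet (face j) ⊆? Q) (starSet (face j) ≟ᵛ Q)
        where
        ⊆⇒≡ : starSet (face j) ⊆ Q → starSet (face j) ≡ Q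
        ⊆⇒≡ sj⊆Q = ⊆∧∣≡∣⇒≡ sj⊆Q (trans (∣starSet∣≡m j) (sym (∣starSet∣≡m i)))
      π : Fin (2 ^ k) → Bool → Bool
      π j b = does (parity (∁ Q) (corner (face j)) ≟ b)
      balanced : ofParity true ≡ ofParity false
      balanced = trans (sum-cong-≗ (λ j → cong (λ z → 𝟙 (z ∧ π j true)) (sym (⊆Q≡==Q j))))
        (trans (covering-balanced-⊆ face isFace volume covers Q ∁Q≢∅)
               (sum-cong-≗ (λ j → cong (λ z → 𝟙 (z ∧ π j false)) (⊆Q≡==Q j))))

    -- As |∁ T| is even, a face and its antipode have the same ∁ T-parity, so the faces with a
    -- given star set inside T contribute an even number to each side of covering-balanced.
    module _ (T : Subset n) (∁T≢∅ : ∁ T ≢ ∅) (∣∁T∣-even : isOdd ∣ ∁ T ∣ ≡ false) where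

      parityMultiplicity-even : ∀ b Q → Q ⊆ T → 2 ∣ parityMultiplicity (∁ T) b Q
      parityMultiplicity-even b Q Q⊆T with any? (λ i → starSet (face i) ≟ᵛ Q)
      ... | no  unoccupied = subst (2 ∣_) (sym (n≤0⇒n≡0 (≤-trans (parityMultiplicity-≤ (∁ T) b Q)
                                                    (≤-reflexive (multiplicity-unoccupied Q unoccupied))))) (2 ∣0)
      ... | yes (i , refl) = subst (2 ∣_) (sym uniform) (∣n⇒∣m*n (𝟙 (does (p ≟ b))) (multiplicity-even Q))
        where
        p = parity (∁ T) (corner (face i))
        sameParity : ∀ j → starSet (face j) ≡ Q → parity (∁ T) (corner (face j)) ≡ p
        sameParity j sj≡Q with sameStarSet⇒≡⊎antipode i j sj≡Q
        ... | inj₁ fj≡fi = cong (parity (∁ T) ∘ corner) fj≡fi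
        ... | inj₂ fj≡f̄i = begin
          parity (∁ T) (corner (face j))             ≡⟨ cong (parity (∁ T) ∘ corner) fj≡f̄i ⟩
          parity (∁ T) (corner (antipode (face i)))  ≡⟨ parity-antipode (∁ T) (face i) (starSet⊆⇒restrict∁≡∅ T (face i) Q⊆T) ⟩
          p xor parity (∁ T) ⊤                       ≡⟨ cong (p xor_) (trans (parity-⊤ (∁ T)) ∣∁T∣-even) ⟩
          p xor false                                ≡⟨ xor-identityʳ p ⟩
          p                                          ∎
          where open ≡-Reasoning
        pointwise : ∀ j → 𝟙 (starSet (face j) == Q ∧ does (parity (∁ T) (corner (face j)) ≟ b)) ≡
                          𝟙 (does (p ≟ b)) * 𝟙 (starSet (face j) == Q)
        pointwise j with starSet (face j) ≟ᵛ Q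
        ... | yes sj≡Q = trans (cong (λ z → 𝟙 (does (z ≟ b))) (sameParity j sj≡Q)) (sym (*-identityʳ (𝟙 (does (p ≟ b)))))
        ... | no  _    = sym (*-zeroʳ (𝟙 (does (p ≟ b))))
        uniform : parityMultiplicity (∁ T) b Q ≡ 𝟙 (does (p ≟ b)) * multiplicity Q
        uniform = trans (sum-cong-≗ pointwise)
                        (sym (*-distribˡ-sum {2 ^ k} (𝟙 (does (p ≟ b))) (λ j → 𝟙 (starSet (face j) == Q))))

      ∑ᶜ-parityMultiplicity-inside : ∀ b →
        ∑ᶜ n (λ Q → 𝟙 (does (Q ⊆? T)) * parityMultiplicity (∁ T) b Q) ≡
        ∑[ i < 2 ^ k ] 𝟙 (does (starSet (face i) ⊆? T) ∧ does (parity (∁ T) (corner (face i)) ≟ b))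
      ∑ᶜ-parityMultiplicity-inside b = begin
        ∑ᶜ n (λ Q → 𝟙 (does (Q ⊆? T)) * parityMultiplicity (∁ T) b Q)
          ≡⟨ ∑ᶜ-cong n (λ Q → *-distribˡ-sum {2 ^ k} (𝟙 (does (Q ⊆? T))) (λ i → 𝟙 (starSet (face i) == Q ∧ π i))) ⟩
        ∑ᶜ n (λ Q → ∑[ i < 2 ^ k ] (𝟙 (does (Q ⊆? T)) * 𝟙 (starSet (face i) == Q ∧ π i)))
          ≡⟨ ∑ᶜ-cong n (λ Q → sum-cong-≗ (regroup Q)) ⟩
        ∑ᶜ n (λ Q → ∑[ i < 2 ^ k ] (𝟙 (starSet (face i) == Q) * 𝟙 (does (starSet (face i) ⊆? T) ∧ π i)))
          ≡⟨ ∑-by-fibres (starSet ∘ face) _ ⟩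
        ∑[ i < 2 ^ k ] 𝟙 (does (starSet (face i) ⊆? T) ∧ π i) ∎
        where
        open ≡-Reasoning
        π : Fin (2 ^ k) → Bool
        π i = does (parity (∁ T) (corner (face i)) ≟ b)
        regroup : ∀ Q i → 𝟙 (does (Q ⊆? T)) * 𝟙 (starSet (face i) == Q ∧ π i) ≡
                          𝟙 (starSet (face i) == Q) * 𝟙 (does (starSet (face i) ⊆? T) ∧ π i)
        regroup Q i with starSet (face i) ≟ᵛ Q
        ... | yes refl = trans (sym (𝟙-∧ _ (π i))) (sym (+-identityʳ _))
        ... | no  _    = *-zeroʳ (𝟙 (does (Q ⊆? T)))

      4∣facesInside : 4 ∣ facesInside T
      4∣facesInside = subst (4 ∣_) (sym facesInside≡2*A) (*-monoʳ-∣ 2 A-even)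
        where
        A : Bool → ℕ
        A b = ∑ᶜ n (λ Q → 𝟙 (does (Q ⊆? T)) * parityMultiplicity (∁ T) b Q)
        A-balanced : A true ≡ A false
        A-balanced = trans (∑ᶜ-parityMultiplicity-inside true)
          (trans (covering-balanced-⊆ face isFace volume covers T ∁T≢∅) (sym (∑ᶜ-parityMultiplicity-inside false)))
        A-even : 2 ∣ A true
        A-even = ∑ᶜ-∣ n even
          where
          even : ∀ Q → 2 ∣ 𝟙 (does (Q ⊆? T)) * parityMultiplicity (∁ T) true Q
          even Q with Q ⊆? T
          ... | yes Q⊆T = ∣n⇒∣m*n 1 (parityMultiplicity-even true Q Q⊆T)
          ... | no  _   = 2 ∣0
        facesInside≡2*A : facesInside T ≡ 2 * A true
        facesInside≡2*A = begin
          facesInside T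
            ≡⟨ ∑ᶜ-cong n (λ Q → trans (cong (𝟙 (does (Q ⊆? T)) *_) (multiplicity-split (∁ T) Q))
                                      (*-distribˡ-+ (𝟙 (does (Q ⊆? T))) _ _)) ⟩
          ∑ᶜ n (λ Q → 𝟙 (does (Q ⊆? T)) * parityMultiplicity (∁ T) true Q
                    + 𝟙 (does (Q ⊆? T)) * parityMultiplicity (∁ T) false Q)
            ≡⟨ ∑ᶜ-distrib-+ n _ _ ⟩
          A true + A false  ≡⟨ cong (A true +_) A-balanced ⟨
          A true + A true   ≡⟨ trans (m+m≡m*2 (A true)) (*-comm (A true) 2) ⟩
          2 * A true        ∎
          where open ≡-Reasoning

-- Binomial estimates

2*[2+k]≤2^k : ∀ {k} → 4 ≤ k → 2 * (2 + k) ≤ 2 ^ k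
2*[2+k]≤2^k {suc k} 4≤k with m≤n⇒m<n∨m≡n 4≤k
... | inj₂ refl       = ≤ᵇ⇒≤ 12 16 _
... | inj₁ (s≤s 4≤k′) = begin
  2 * (3 + k)      ≡⟨ *-distribˡ-+ 2 1 (2 + k) ⟩
  2 + 2 * (2 + k)  ≤⟨ +-mono-≤ (≤-trans (*-monoʳ-≤ 2 (s≤s {n = suc k} z≤n)) IH) IH ⟩
  2 ^ k + 2 ^ k    ≡⟨ cong (2 ^ k +_) (+-identityʳ (2 ^ k)) ⟨
  2 ^ suc k        ∎
  where
  open ≤-Reasoning
  IH = 2*[2+k]≤2^k 4≤k′

[2+k]*[1+k]<2^k : ∀ {k} → 6 ≤ k → (2 + k) * (1 + k) < 2 ^ k
[2+k]*[1+k]<2^k {suc k} 6≤k with m≤n⇒m<n∨m≡n 6≤k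
... | inj₂ refl       = ≤ᵇ⇒≤ 57 64 _
... | inj₁ (s≤s 6≤k′) = begin-strict
  (3 + k) * (2 + k)                ≡⟨ expand k ⟩
  (2 + k) * (1 + k) + 2 * (2 + k)  <⟨ +-mono-<-≤ ([2+k]*[1+k]<2^k 6≤k′) (2*[2+k]≤2^k (≤-trans (n≤1+n 4) (≤-trans (n≤1+n 5) 6≤k′))) ⟩
  2 ^ k + 2 ^ k                    ≡⟨ cong (2 ^ k +_) (+-identityʳ (2 ^ k)) ⟨
  2 ^ suc k                        ∎
  where
  open ≤-Reasoning
  expand : ∀ k → (3 + k) * (2 + k) ≡ (2 + k) * (1 + k) + 2 * (2 + k)
  expand = solve-∀

2*[1+n]C2≡[1+n]*n : ∀ n → 2 * (suc n C 2) ≡ suc n * n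
2*[1+n]C2≡[1+n]*n zero    = refl
2*[1+n]C2≡[1+n]*n (suc n) = begin
  2 * (suc (suc n) C 2)              ≡⟨ cong (2 *_) (nCk+nC[k+1]≡[n+1]C[k+1] (suc n) 1) ⟨
  2 * (suc n C 1 + suc n C 2)        ≡⟨ *-distribˡ-+ 2 (suc n C 1) (suc n C 2) ⟩
  2 * (suc n C 1) + 2 * (suc n C 2)  ≡⟨ cong₂ (λ a b → 2 * a + b) (nC1≡n (suc n)) (2*[1+n]C2≡[1+n]*n n) ⟩
  2 * (1 + n) + (1 + n) * n          ≡⟨ collect n ⟩
  (2 + n) * (1 + n)                  ∎
  where
  open ≡-Reasoning
  collect : ∀ n → 2 * (1 + n) + (1 + n) * n ≡ (2 + n) * (1 + n)
  collect = solve-∀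

2*[m+k]Cm<2^k : ∀ {k} m → 5 ≤ k → m ≤ 2 → ¬ (k ≡ 5 × m ≡ 2) → 2 * ((m + k) C m) < 2 ^ k
2*[m+k]Cm<2^k {k} 0 5≤k _ _ = <-≤-trans (*-monoʳ-< 2 (s≤s (s≤s z≤n))) (2*[2+k]≤2^k (≤-trans (n≤1+n 4) 5≤k))
2*[m+k]Cm<2^k {k} 1 5≤k _ _ = begin-strict
  2 * (suc k C 1)  ≡⟨ cong (2 *_) (nC1≡n (suc k)) ⟩
  2 * (1 + k)      <⟨ *-monoʳ-< 2 (n<1+n (suc k)) ⟩
  2 * (2 + k)      ≤⟨ 2*[2+k]≤2^k (≤-trans (n≤1+n 4) 5≤k) ⟩
  2 ^ k            ∎
  where open ≤-Reasoning
2*[m+k]Cm<2^k {k} 2 5≤k _ ¬k≡5×2≡2 with m≤n⇒m<n∨m≡n 5≤k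
... | inj₂ refl = contradiction (refl , refl) ¬k≡5×2≡2
... | inj₁ 6≤k  = subst (_< 2 ^ k) (sym (2*[1+n]C2≡[1+n]*n (suc k))) ([2+k]*[1+k]<2^k 6≤k)
2*[m+k]Cm<2^k (suc (suc (suc _))) _ (s≤s (s≤s ())) _

-- Thirty-two squares in Q_2^7

supersets-of-pairs : ∀ (Q : Subset 7) → ∣ Q ∣ ≡ 2 →
                     ∑ᶜ 7 (λ T → 𝟙 (does (∣ T ∣ ≟ℕ 3)) * 𝟙 (does (Q ⊆? T))) ≡ 5
supersets-of-pairs Q = decidable-stable (claim? Q) (λ ¬claim → from-no (anySubset? (¬? ∘ claim?)) (Q , ¬claim))
  where
  claim? : ∀ Q → Dec (∣ Q ∣ ≡ 2 → ∑ᶜ 7 (λ T → 𝟙 (does (∣ T ∣ ≟ℕ 3)) * 𝟙 (does (Q ⊆? T))) ≡ 5)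
  claim? Q = (∣ Q ∣ ≟ℕ 2) →-dec (∑ᶜ 7 (λ T → 𝟙 (does (∣ T ∣ ≟ℕ 3)) * 𝟙 (does (Q ⊆? T))) ≟ℕ 5)

4∣∧≤6⇒≤4 : ∀ {x} → 4 ∣ x → x ≤ 6 → x ≤ 4
4∣∧≤6⇒≤4 (divides 0 refl) _ = z≤n
4∣∧≤6⇒≤4 (divides 1 refl) _ = ≤-refl
4∣∧≤6⇒≤4 (divides (suc (suc q)) refl) x≤6 = contradiction x≤6 (<⇒≱ (≤-trans (≤ᵇ⇒≤ 7 8 _) (m≤m+n 8 (q * 4))))

module _ (S : AntipodalSplitting 7 5) where
  open AntipodalSplitting S using (m; dim)

  μ : Subset 7 → ℕ
  μ = multiplicity S

  μ-≤ : ∀ Q → μ Q ≤ 2 * 𝟙 (does (∣ Q ∣ ≟ℕ 2))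
  μ-≤ Q = subst (λ m → μ Q ≤ 2 * 𝟙 (does (∣ Q ∣ ≟ℕ m))) (+-cancelˡ-≡ 5 m 2 dim) (multiplicity-≤ S Q)

  facesInside-≤4 : ∀ T → ∣ T ∣ ≡ 3 → facesInside S T ≤ 4
  facesInside-≤4 T ∣T∣≡3 = 4∣∧≤6⇒≤4 (4∣facesInside S (s≤s z≤n) T ∁T≢∅ ∣∁T∣-even) (begin
    facesInside S T
      ≤⟨ ∑ᶜ-mono 7 (λ Q → *-monoʳ-≤ (𝟙 (does (Q ⊆? T))) (μ-≤ Q)) ⟩
    ∑ᶜ 7 (λ Q → 𝟙 (does (Q ⊆? T)) * (2 * 𝟙 (does (∣ Q ∣ ≟ℕ 2))))
      ≡⟨ ∑ᶜ-cong 7 (λ Q → rearrange (𝟙 (does (Q ⊆? T))) (𝟙 (does (∣ Q ∣ ≟ℕ 2)))) ⟩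
    ∑ᶜ 7 (λ Q → 2 * (𝟙 (does (Q ⊆? T)) * 𝟙 (does (∣ Q ∣ ≟ℕ 2))))
      ≡⟨ ∑ᶜ-*-distribˡ 7 2 (λ Q → 𝟙 (does (Q ⊆? T)) * 𝟙 (does (∣ Q ∣ ≟ℕ 2))) ⟩
    2 * ∑ᶜ 7 (λ Q → 𝟙 (does (Q ⊆? T)) * 𝟙 (does (∣ Q ∣ ≟ℕ 2)))
      ≡⟨ cong (2 *_) (∑ᶜ-cong 7 (λ Q → 𝟙-∧ (does (Q ⊆? T)) (does (∣ Q ∣ ≟ℕ 2)))) ⟨
    2 * ∑ᶜ 7 (λ Q → 𝟙 (does (Q ⊆? T) ∧ does (∣ Q ∣ ≟ℕ 2)))
      ≡⟨ cong (2 *_) (∑ᶜ-subsets T 2) ⟩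
    2 * (∣ T ∣ C 2)
      ≡⟨ cong (λ t → 2 * (t C 2)) ∣T∣≡3 ⟩
    6 ∎)
    where
    open ≤-Reasoning
    rearrange : ∀ a b → a * (2 * b) ≡ 2 * (a * b)
    rearrange = solve-∀
    ∣∁T∣≡4 : ∣ ∁ T ∣ ≡ 4
    ∣∁T∣≡4 = trans (∣∁p∣≡n∸∣p∣ T) (cong (7 ∸_) ∣T∣≡3)
    ∁T≢∅ : ∁ T ≢ ∅
    ∁T≢∅ = ∣p∣<n⇒∁p≢∅ T (subst (_< 7) (sym ∣T∣≡3) (≤ᵇ⇒≤ 4 7 _))
    ∣∁T∣-even : isOdd ∣ ∁ T ∣ ≡ false
    ∣∁T∣-even = cong isOdd ∣∁T∣≡4

  supersets : Subset 7 → ℕ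
  supersets Q = ∑ᶜ 7 (λ T → 𝟙 (does (∣ T ∣ ≟ℕ 3)) * 𝟙 (does (Q ⊆? T)))

  μ*supersets : ∀ Q → μ Q * supersets Q ≡ 5 * μ Q
  μ*supersets Q with ∣ Q ∣ ≟ℕ 2
  ... | yes ∣Q∣≡2 = trans (cong (μ Q *_) (supersets-of-pairs Q ∣Q∣≡2)) (*-comm (μ Q) 5)
  ... | no  ∣Q∣≢2 = trans (cong (_* supersets Q) μQ≡0) (sym (cong (5 *_) μQ≡0))
    where
    μQ≡0 : μ Q ≡ 0
    μQ≡0 = n≤0⇒n≡0 (≤-trans (μ-≤ Q) (≤-reflexive (cong (λ z → 2 * 𝟙 z) (dec-false (∣ Q ∣ ≟ℕ 2) ∣Q∣≢2))))

  double-count : 5 * 2 ^ 5 ≤ 4 * 35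
  double-count = begin
    5 * 2 ^ 5
      ≡⟨ cong (5 *_) (∑ᶜ-multiplicity S) ⟨
    5 * ∑ᶜ 7 μ
      ≡⟨ ∑ᶜ-*-distribˡ 7 5 μ ⟨
    ∑ᶜ 7 (λ Q → 5 * μ Q)
      ≡⟨ ∑ᶜ-cong 7 μ*supersets ⟨
    ∑ᶜ 7 (λ Q → μ Q * supersets Q)
      ≡⟨ ∑ᶜ-cong 7 (λ Q → ∑ᶜ-*-distribˡ 7 (μ Q) (λ T → triple T * 𝟙 (does (Q ⊆? T)))) ⟨
    ∑ᶜ 7 (λ Q → ∑ᶜ 7 (λ T → μ Q * (triple T * 𝟙 (does (Q ⊆? T)))))
      ≡⟨ ∑ᶜ-cong 7 (λ Q → ∑ᶜ-cong 7 (λ T → reorder (μ Q) (triple T) (𝟙 (does (Q ⊆? T))))) ⟩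
    ∑ᶜ 7 (λ Q → ∑ᶜ 7 (λ T → triple T * (𝟙 (does (Q ⊆? T)) * μ Q)))
      ≡⟨ ∑ᶜ-comm 7 7 (λ Q T → triple T * (𝟙 (does (Q ⊆? T)) * μ Q)) ⟩
    ∑ᶜ 7 (λ T → ∑ᶜ 7 (λ Q → triple T * (𝟙 (does (Q ⊆? T)) * μ Q)))
      ≡⟨ ∑ᶜ-cong 7 (λ T → ∑ᶜ-*-distribˡ 7 (triple T) (λ Q → 𝟙 (does (Q ⊆? T)) * μ Q)) ⟩
    ∑ᶜ 7 (λ T → triple T * facesInside S T)
      ≤⟨ ∑ᶜ-mono 7 (λ T → bound T (∣ T ∣ ≟ℕ 3)) ⟩
    ∑ᶜ 7 (λ T → triple T * 4)
      ≡⟨⟩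
    4 * 35 ∎
    where
    open ≤-Reasoning
    triple : Subset 7 → ℕ
    triple T = 𝟙 (does (∣ T ∣ ≟ℕ 3))
    reorder : ∀ μ t s → μ * (t * s) ≡ t * (s * μ)
    reorder = solve-∀
    bound : ∀ T (d : Dec (∣ T ∣ ≡ 3)) → 𝟙 (does d) * facesInside S T ≤ 𝟙 (does d) * 4
    bound T (yes ∣T∣≡3) = *-monoʳ-≤ 1 (facesInside-≤4 T ∣T∣≡3)
    bound T (no  _)     = z≤n

¬AntipodalSplitting-7-5 : ¬ AntipodalSplitting 7 5
¬AntipodalSplitting-7-5 S = <⇒≱ (≤ᵇ⇒≤ 141 160 _) (double-count S)

proposition17 : (k n : ℕ) → 5 ≤ k → n ≤ k + 2 → ¬ AntipodalSplitting n k
proposition17 k n 5≤k n≤k+2 S = case (k ≟ℕ 5) ×-dec (m ≟ℕ 2) of λ where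
    (yes (k≡5 , m≡2)) → ¬AntipodalSplitting-7-5
                          (subst₂ AntipodalSplitting (trans n≡m+k (cong₂ _+_ m≡2 k≡5)) k≡5 S)
    (no  ¬k≡5×m≡2)    → <⇒≱ (2*[m+k]Cm<2^k m 5≤k m≤2 ¬k≡5×m≡2)
                          (subst (λ n → 2 ^ k ≤ 2 * (n C m)) n≡m+k (splitting-bound S))
  where
  open AntipodalSplitting S using (m; dim)
  n≡m+k : n ≡ m + k
  n≡m+k = trans (sym dim) (+-comm k m)
  m≤2 : m ≤ 2
  m≤2 = +-cancelˡ-≤ k m 2 (subst (_≤ k + 2) (sym dim) n≤k+2)
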